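{- Suppose that for every pair of consecutive primes $p_{n-1}<p_n$ such that $p_n$ is a Legendre prime, the inequality $p_n-p_{n-1}<2\sqrt{p_n}+1$ holds. Then for every integer $n\ge 2$ there is a prime $p$ with $(n-1)^2<p<n^2$.
   Context: $p_1=2,p_2=3,\dots$ denotes the sequence of primes in increasing order. A prime $p$ is called a Legendre prime if there is an integer $a\ge1$ such that $p$ is the smallest prime greater than $a^2$ (i.e. $p_{n-1}<a^2<p_n=p$); the Legendre primes are $2,5,11,17,29,37,53,\dots$. -}

module Defs where

open import Data.Nat using (ℕ; _<_; _≤_; _*_; _∸_; _+_)
open import Data.Nat.Primality using (Prime)
open import Data.Product using (_×_; ∃-syntax)
open import Relation.Nullary using (¬_)

ConsecutivePrimes : ℕ → ℕ → Set
ConsecutivePrimes q p = Prime q × Prime p × q < p × (∀ r → q < r → r < p → ¬ Prime r)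

-- For consecutive primes q < p, p is the Legendre prime "next after a²"
-- for some a ≥ 1:  q < a² < p.
LegendreAfter : ℕ → ℕ → Set
LegendreAfter q p = ∃[ a ] (1 ≤ a × q < a * a × a * a < p)

-- Integer rendering of  d < 2√p + 1  for a natural number d ≥ 1:
-- d < 2√p + 1  ⇔  d - 1 < 2√p  ⇔  (d - 1)² < 4p.
GapBound : ℕ → ℕ → Set
GapBound d p = (d ∸ 1) * (d ∸ 1) < 4 * p

-- Let q < k² < p be the primes around k² = (n − 1)²; they are consecutive since k² is not
-- prime. If there were no prime in ((n − 1)², n²), then p > n², so p is the Legendre prime
-- after n² and the hypothesis bounds p − q. Writing q = k² − 1 − u and p = n² + 1 + s, the
-- bound (p − q − 1)² < 4p reads (2n + u + s)² < 4(n² + 1 + s), which forces u = s = 0.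
-- But k² − 1 and (k + 1)² + 1 are never both prime.
module Submission where

open import Defs
open import Data.Nat using (ℕ; _<_; _≤_; _*_; _∸_)
open import Data.Nat.Primality using (Prime)
open import Data.Product using (_×_; ∃-syntax)

open import Data.Nat.Base using (suc; zero; _+_; _!; NonZero; >-nonZero⁻¹; z≤n; s≤s)
open import Data.Nat.Properties
open import Data.Nat.Primality using (prime?; prime[2]; ¬prime[0]; ¬prime[1]; composite; composite⇒¬prime; prime⇒nonZero)
open import Data.Nat.Primality.Factorisation using (factorise)
open import Data.Nat.Divisibility using (_∣_; divides; ∣-trans; m∣m*n; m≤n⇒m!∣n!; ∣1⇒≡1; ∣m+n∣m⇒∣n)
open import Data.Nat.Tactic.RingSolver using (solve-∀)
open import Data.List.Base using ([]; _∷_)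
open import Data.List.Relation.Unary.All using (_∷_)
open import Data.Product using (_,_)
open import Data.Sum using (_⊎_; inj₁; inj₂)
open import Function using (case_of_)
open import Relation.Nullary using (¬_; yes; no)
open import Relation.Nullary.Decidable using (_×-dec_)
open import Relation.Nullary.Negation using (contradiction)
open import Relation.Unary using (Pred; Decidable)
open import Relation.Binary.Definitions using (tri<; tri≈; tri>)
open import Relation.Binary.PropositionalEquality using (_≡_; refl; sym; trans; cong; subst; module ≡-Reasoning)
open import Level using (0ℓ)

NoneStrictlyBetween : Pred ℕ 0ℓ → ℕ → ℕ → Set
NoneStrictlyBetween P a b = ∀ r → a < r → r < b → ¬ P r

none-between-join : ∀ {P a b c} → NoneStrictlyBetween P a b → ¬ P b → NoneStrictlyBetween P b c →
                    NoneStrictlyBetween P a c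
none-between-join {b = b} none-ab ¬Pb none-bc r a<r r<c with <-cmp r b
... | tri< r<b _ _ = none-ab r a<r r<b
... | tri≈ _ refl _ = ¬Pb
... | tri> _ _ b<r = none-bc r b<r r<c

none-between-successor : ∀ {P} a → NoneStrictlyBetween P a (suc a)
none-between-successor a r a<r r<1+a = contradiction r<1+a (≤⇒≯ a<r)

module _ {P : Pred ℕ 0ℓ} (P? : Decidable P) where

  greatest-below : ∀ {b A} → b < A → P b → ∃[ q ] (P q × q < A × NoneStrictlyBetween P q A)
  greatest-below {A = suc A} b<1+A Pb with P? A
  ... | yes PA = A , PA , n<1+n A , none-between-successor A
  ... | no ¬PA with m<1+n⇒m<n∨m≡n b<1+A
  ...   | inj₂ refl = contradiction Pb ¬PA
  ...   | inj₁ b<A with greatest-below b<A Pb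
  ...     | q , Pq , q<A , none = q , Pq , m<n⇒m<1+n q<A , 
                      none-between-join none ¬PA (none-between-successor A)

  least-above-or-none : ∀ m k → ∃[ p ] (P p × m < p × NoneStrictlyBetween P m p)
                                ⊎ NoneStrictlyBetween P m (suc k)
  least-above-or-none m zero = inj₂ λ { zero () ; (suc r) _ (s≤s ()) }
  least-above-or-none m (suc k) with least-above-or-none m k
  ... | inj₁ least = inj₁ least
  ... | inj₂ none with P? (suc k) ×-dec m <? suc k
  ...   | yes (Pk , m<k) = inj₁ (suc k , Pk , m<k , none)
  ...   | no ¬[Pk×m<k] = inj₂ λ r m<r r<2+k → case m<1+n⇒m<n∨m≡n r<2+k of λ
            { (inj₁ r<1+k) → none r m<r r<1+k
            ; (inj₂ refl) Pr → ¬[Pk×m<k] (Pr , m<r) }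

  least-above : ∀ {m k} → m < k → P k → ∃[ p ] (P p × m < p × NoneStrictlyBetween P m p)
  least-above {m} {k} m<k Pk with least-above-or-none m k
  ... | inj₁ least = least
  ... | inj₂ none = contradiction Pk (none k m<k (n<1+n k))

prime-divisor : ∀ n .{{_ : NonZero n}} → 1 < n → ∃[ p ] (Prime p × p ∣ n)
prime-divisor n 1<n with factorise n
... | record { factors = [] ; isFactorisation = n≡1 } = contradiction n≡1 (>⇒≢ 1<n)
... | record { factors = p ∷ ps ; isFactorisation = n≡p*ps ; factorsPrime = prime-p ∷ _ } =
  p , prime-p , subst (p ∣_) (sym n≡p*ps) (m∣m*n _)

m≤n⇒m∣n! : ∀ {m n} → 0 < m → m ≤ n → m ∣ n !
m≤n⇒m∣n! {suc m} _ 1+m≤n = ∣-trans (m∣m*n (m !)) (m≤n⇒m!∣n! 1+m≤n)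

-- Euclid: a prime factor of N ! + 1 cannot be at most N.
prime-above : ∀ N → ∃[ p ] (Prime p × N < p)
prime-above N with prime-divisor (suc (N !)) (s≤s (1≤n! N))
... | p , prime-p , p∣1+N! with N <? p
...   | yes N<p = p , prime-p , N<p
...   | no N≮p = contradiction (subst Prime (∣1⇒≡1 p∣1) prime-p) ¬prime[1]
  where
  p∣N! : p ∣ N !
  p∣N! = m≤n⇒m∣n! (>-nonZero⁻¹ p {{prime⇒nonZero prime-p}}) (≮⇒≥ N≮p)
  p∣1 : p ∣ 1
  p∣1 = ∣m+n∣m⇒∣n (subst (p ∣_) (+-comm 1 (N !)) p∣1+N!) p∣N!

consecutivePrimes-around : ∀ A → 2 < A → ¬ Prime A → ∃[ q ] ∃[ p ] (ConsecutivePrimes q p × q < A × A < p)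
consecutivePrimes-around A 2<A ¬prime-A
  with greatest-below prime? 2<A prime[2] | prime-above A
... | q , prime-q , q<A , none-qA | k , prime-k , A<k with least-above prime? A<k prime-k
...   | p , prime-p , A<p , none-Ap =
  q , p , (prime-q , prime-p , <-trans q<A A<p , none-between-join none-qA ¬prime-A none-Ap) , q<A , A<p

square-not-prime : ∀ {n} → 1 < n → ¬ Prime (n * n)
square-not-prime {n@(suc (suc _))} _ = composite⇒¬prime (composite (m<m*n n n (s≤s (s≤s z≤n))) (m∣m*n n))

square-neighbours-not-both-prime : ∀ k → ¬ (Prime (k * k ∸ 1) × Prime (suc (suc k * suc k)))
square-neighbours-not-both-prime 0 (prime-0 , _) = ¬prime[0] prime-0
square-neighbours-not-both-prime 1 (prime-0 , _) = ¬prime[0] prime-0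
square-neighbours-not-both-prime 2 (_ , prime-10) =
  composite⇒¬prime (composite {2} (s≤s (s≤s (s≤s z≤n))) (divides 5 refl)) prime-10
square-neighbours-not-both-prime (suc (suc (suc j))) (prime-q , _) =
  composite⇒¬prime (composite (m<m*n (2 + j) (4 + j) (s≤s (s≤s z≤n))) (m∣m*n (4 + j)))
    (subst Prime (cong (_∸ 1) (difference-of-squares j)) prime-q)
  where
  difference-of-squares : ∀ j → (3 + j) * (3 + j) ≡ suc ((2 + j) * (4 + j))
  difference-of-squares = solve-∀

gapBound-window : ∀ i u s → (2 * (2 + i) + u + s) * (2 * (2 + i) + u + s) < 4 * (suc ((2 + i) * (2 + i)) + s)
                  → u ≡ 0 × s ≡ 0
gapBound-window i zero zero _ = refl , refl
gapBound-window i (suc u) s gb = contradiction gb (≤⇒≯ (≤-trans (m≤m+n _ _) (≤-reflexive (sym (expand i u s)))))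
  where
  expand : ∀ i u s → (2 * (2 + i) + suc u + s) * (2 * (2 + i) + suc u + s)
           ≡ 4 * (suc ((2 + i) * (2 + i)) + s) + (4 + 4 * s + 8 * u + 4 * i * (suc u + s) + (suc u + s) * (suc u + s))
  expand = solve-∀
gapBound-window i zero (suc s) gb = contradiction gb (≤⇒≯ (≤-trans (m≤m+n _ _) (≤-reflexive (sym (expand i s)))))
  where
  expand : ∀ i s → (2 * (2 + i) + 0 + suc s) * (2 * (2 + i) + 0 + suc s)
           ≡ 4 * (suc ((2 + i) * (2 + i)) + suc s) + (4 * s + 4 * i * suc s + suc s * suc s)
  expand = solve-∀

gap-across-squares : ∀ k q u s → suc q + u ≡ k * k → suc (suc k * suc k) + s ∸ q ≡ suc (2 * suc k + u + s)
gap-across-squares k q u s 1+q+u≡k² = begin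
  suc (suc k * suc k) + s ∸ q         ≡⟨ cong (_∸ q) (expand-square k s) ⟩
  k * k + (2 * k + 2 + s) ∸ q         ≡⟨ cong (λ x → x + (2 * k + 2 + s) ∸ q) (sym 1+q+u≡k²) ⟩
  suc q + u + (2 * k + 2 + s) ∸ q     ≡⟨ cong (_∸ q) (regroup q u k s) ⟩
  q + suc (2 * suc k + u + s) ∸ q     ≡⟨ m+n∸m≡n q _ ⟩
  suc (2 * suc k + u + s)             ∎
  where
  open ≡-Reasoning
  expand-square : ∀ k s → suc (suc k * suc k) + s ≡ k * k + (2 * k + 2 + s)
  expand-square = solve-∀
  regroup : ∀ q u k s → suc q + u + (2 * k + 2 + s) ≡ q + suc (2 * suc k + u + s)
  regroup = solve-∀

gapBound⇒q≡k²∸1∧p≡[1+k]²+1 : ∀ k q p → q < k * k → suc k * suc k < p → GapBound (p ∸ q) p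
                              → q ≡ k * k ∸ 1 × p ≡ suc (suc k * suc k)
gapBound⇒q≡k²∸1∧p≡[1+k]²+1 zero q p () _ _
gapBound⇒q≡k²∸1∧p≡[1+k]²+1 (suc i) q p q<k² n²<p gb
  with m≤n⇒∃[o]m+o≡n q<k² | m≤n⇒∃[o]m+o≡n n²<p
... | u , 1+q+u≡k² | s , refl
  with gapBound-window i u s (subst (λ d → (d ∸ 1) * (d ∸ 1) < 4 * p) (gap-across-squares (suc i) q u s 1+q+u≡k²) gb)
... | refl , refl = cong (_∸ 1) (trans (sym (+-identityʳ (suc q))) 1+q+u≡k²) , +-identityʳ _

LegendreGapHypothesis : Set
LegendreGapHypothesis = ∀ q p → ConsecutivePrimes q p → LegendreAfter q p → GapBound (p ∸ q) p

¬consecutivePrimes-across-two-squares : LegendreGapHypothesis → ∀ k q p → ConsecutivePrimes q p →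
                                         q < k * k → ¬ (suc k * suc k < p)
¬consecutivePrimes-across-two-squares H k q p consecutive@(prime-q , prime-p , _) q<k² n²<p
  with gapBound⇒q≡k²∸1∧p≡[1+k]²+1 k q p q<k² n²<p (H q p consecutive legendre)
  where
  legendre : LegendreAfter q p
  legendre = suc k , s≤s z≤n , <-≤-trans q<k² (*-mono-≤ (n≤1+n k) (n≤1+n k)) , n²<p
... | refl , refl = square-neighbours-not-both-prime k (prime-q , prime-p)

prime-between-squares : LegendreGapHypothesis → ∀ k → 1 < k → ∃[ p ] (Prime p × k * k < p × p < suc k * suc k)
prime-between-squares H k@(suc _) 1<k
  with consecutivePrimes-around (k * k) (≤-<-trans 1<k (m<m*n k k 1<k)) (square-not-prime 1<k)
... | q , p , consecutive@(_ , prime-p , _) , q<k² , k²<p with p <? suc k * suc k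
...   | yes p<n² = p , prime-p , k²<p , p<n²
...   | no p≮n² = contradiction n²<p (¬consecutivePrimes-across-two-squares H k q p consecutive q<k²)
  where
  n²<p : suc k * suc k < p
  n²<p = ≤∧≢⇒< (≮⇒≥ p≮n²) λ n²≡p → square-not-prime (m<n⇒m<1+n 1<k) (subst Prime (sym n²≡p) prime-p)

theorem18 : (∀ q p → ConsecutivePrimes q p → LegendreAfter q p → GapBound (p ∸ q) p)
    → ∀ n → 2 ≤ n → ∃[ p ] (Prime p × (n ∸ 1) * (n ∸ 1) < p × p < n * n)
theorem18 H (suc zero) (s≤s ())
theorem18 H (suc (suc zero)) _ = 2 , prime[2] , s≤s (s≤s z≤n) , s≤s (s≤s (s≤s z≤n))
theorem18 H (suc k@(suc (suc _))) _ = prime-between-squares H k (s≤s (s≤s z≤n))
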